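{- Let $n>2$ be even. There exists an $(n-3)$-regular cyclic Cayley graph on $n$ vertices which has no internal partition if and only if $n$ is not a power of $2$.
   Context: A cyclic Cayley graph on $n$ vertices is $Cay(\mathbb{Z}_n;S)$ with $0\notin S$, $S=-S$: vertex set $\mathbb{Z}_n$, $x\sim y$ iff $y-x\in S$; it is $|S|$-regular. An internal partition of a graph is a partition of the vertex set into two nonempty sets such that every vertex has at least as many neighbours in its own class as in the other class. -}

module Defs where

open import Data.Nat using (ℕ; _∸_; _≤_; NonZero)
open import Data.Nat.DivMod using (_mod_)
open import Data.Fin using (Fin; toℕ; zero)
open import Data.Fin.Subset using (Subset; _∈_; _∉_; ∣_∣; _∩_; ∁; Nonempty)
open import Data.Vec using (tabulate; lookup)
open import Data.Product using (_×_)
open import Relation.Nullary using (¬_)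

module _ (n : ℕ) .{{_ : NonZero n}} where

  diffℤ : Fin n → Fin n → Fin n
  diffℤ x y = (toℕ y Data.Nat.+ (n ∸ toℕ x)) mod n

  negℤ : Fin n → Fin n
  negℤ x = (n ∸ toℕ x) mod n

  zeroℤ : Fin n
  zeroℤ = 0 mod n

  IsConnectionSet : Subset n → Set
  IsConnectionSet S = (zeroℤ ∉ S) × (∀ s → s ∈ S → negℤ s ∈ S)

  nbhd : Subset n → Fin n → Subset n
  nbhd S x = tabulate (λ y → lookup S (diffℤ x y))

  IsInternalPartition : Subset n → Subset n → Set
  IsInternalPartition S A =
    Nonempty A × Nonempty (∁ A) ×
    (∀ x → (x ∈ A → ∣ nbhd S x ∩ ∁ A ∣ ≤ ∣ nbhd S x ∩ A ∣)
         × (x ∉ A → ∣ nbhd S x ∩ A ∣ ≤ ∣ nbhd S x ∩ ∁ A ∣))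

  HasInternalPartition : Subset n → Set
  HasInternalPartition S = Data.Product.∃ (IsInternalPartition S)

module Submission where

-- Let S be a connection set of size n − 3. Its complement is {0, a, −a} with a ≠ −a, so the
-- neighbourhood of x in Cay(ℤ_n; S) is everything except x, x + a and x − a. For a class A
-- containing x, with k of the two vertices x ± a also in A, counting neighbours shows that x
-- satisfies the internal condition iff |∁A| + 2k ≤ |A| + 1. Applied to a vertex of each class
-- this gives ||A| − |∁A|| ≤ 1, hence |A| = |∁A| as n is even, and then k = 0 everywhere: the
-- internal partitions are exactly the sets A with x + a ∈ A ⇔ x ∉ A ("A flips at a"). Such an A
-- exists iff a has even order. If n = 2^k every a ≠ 0 has even order (explicitly, with 2^v the
-- exact power of 2 dividing a, take A = {y : ⌊y / 2^v⌋ even}); if n = (2t + 3) d, then a = d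
-- has odd order and ℤ_n ∖ {0, ±d} is a connection set of size n − 3 with no internal partition.

open import Defs
open import Algebra.Bundles using (AbelianGroup)
import Algebra.Properties.AbelianGroup as AbelianGroupProperties
open import Algebra.Structures using (IsAbelianGroup)
open import Data.Bool using (Bool; true; false; not; _∧_)
open import Data.Bool.Properties using (∧-identityʳ; ∧-zeroʳ; ∧-comm; ∧-assoc; not-involutive; not-¬)
open import Data.Empty using (⊥-elim)
open import Data.Fin using (Fin; zero; suc; toℕ; fromℕ<)
open import Data.Fin.Permutation using (Permutation; permutation; _⟨$⟩ʳ_)
open import Data.Fin.Properties using (_≟_; toℕ-injective; toℕ-fromℕ<; toℕ<n)
open import Data.Fin.Subset using (Subset; inside; outside; _∈_; _∉_; _⊆_; ∣_∣; _∩_; ∁; _-_; ⊤; Nonempty)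
open import Data.Fin.Subset.Properties
  using (p─⊥≡p; p─q⊆p; x∈p∧x≢y⇒x∈p-y; ∈⊤; ∣⊤∣≡n; ∣∁p∣≡n∸∣p∣; ∣p∣≤n; ⊆-antisym; x∈p⇒∣p-x∣<∣p∣;
         x∉p⇒x∈∁p; x∈∁p⇒x∉p; x∉∁p⇒x∈p)
open import Data.Nat
  using (ℕ; zero; suc; _+_; _*_; _∸_; _^_; _≤_; _<_; s≤s; z≤n; NonZero; ≢-nonZero; ≢-nonZero⁻¹; >-nonZero⁻¹)
  renaming (_≟_ to _≟ℕ_)
open import Data.Nat.Divisibility using (_∣_; divides; m∣m*n)
open import Data.Nat.DivMod
  using (_mod_; _%_; _/_; %-distribˡ-+; %-congʳ; m%n%n≡m%n; m%n<n; m<n⇒m%n≡m; n%n≡0; [m+kn]%n≡m%n;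
         m%[n*o]/o≡m/o%n; m∣n⇒o%n%m≡o%m; +-distrib-/-∣ʳ; m*n/n≡m)
open import Data.Nat.Induction using (<-wellFounded)
open import Data.Nat.Properties hiding (_≟_)
open import Data.Nat.Solver using (module +-*-Solver)
open import Algebra.Properties.CommutativeMonoid.Sum +-0-commutativeMonoid using (sum; sum-cong-≗; sum-permute)
open import Data.Product using (∃; ∃-syntax; _×_; _,_; proj₁; proj₂)
open import Data.Sum using (_⊎_; inj₁; inj₂)
open import Data.Vec using (_∷_; []; here; there; lookup; tabulate)
open import Data.Vec.Properties
  using (lookup-map; lookup-zipWith; lookup∘tabulate; tabulate∘lookup; tabulate-cong; map-∘; map-cong; map-id;
         []=⇒lookup; lookup⇒[]=; lookup-replicate)
open import Function using (_∘_; _⇔_; mk⇔; Equivalence)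
open import Induction.WellFounded using (Acc; acc)
open import Relation.Binary.Definitions using (tri<; tri≈; tri>)
open import Relation.Binary.PropositionalEquality
open import Relation.Nullary using (¬_; does; yes; no)
open import Relation.Nullary.Decidable using (dec-false; does-⇔)

-- Arithmetic of ℕ

parity : ∀ m → ∃[ h ] (m ≡ 2 * h ⊎ m ≡ suc (2 * h))
parity zero    = 0 , inj₁ refl
parity (suc m) with parity m
... | h , inj₁ m≡2h   = h , inj₂ (cong suc m≡2h)
... | h , inj₂ m≡1+2h = suc h , inj₁ (trans (cong suc m≡1+2h) (sym (*-suc 2 h)))

2-adic : ∀ m .{{_ : NonZero m}} → ∃[ v ] ∃[ u ] m ≡ suc (2 * u) * 2 ^ v
2-adic m = go m (<-wellFounded m) (≢-nonZero⁻¹ m)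
  where
  go : ∀ m → Acc _<_ m → m ≢ 0 → ∃[ v ] ∃[ u ] m ≡ suc (2 * u) * 2 ^ v
  go m (acc rec) m≢0 with parity m
  ... | h , inj₂ m≡1+2h = 0 , h , trans m≡1+2h (sym (*-identityʳ _))
  ... | h , inj₁ m≡2h with go h (rec h<m) h≢0
    where
    h≢0 : h ≢ 0
    h≢0 h≡0 = m≢0 (trans m≡2h (cong (2 *_) h≡0))
    h<m : h < m
    h<m = subst (h <_) (sym m≡2h) (m<m+n h (subst (0 <_) (sym (+-identityʳ h)) (n≢0⇒n>0 h≢0)))
  ...   | v , u , h≡o*2^v = suc v , u , (begin
    m                            ≡⟨ m≡2h ⟩
    2 * h                        ≡⟨ cong (2 *_) h≡o*2^v ⟩
    2 * (suc (2 * u) * 2 ^ v)    ≡⟨ *-assoc 2 (suc (2 * u)) (2 ^ v) ⟨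
    2 * suc (2 * u) * 2 ^ v      ≡⟨ cong (_* 2 ^ v) (*-comm 2 (suc (2 * u))) ⟩
    suc (2 * u) * 2 * 2 ^ v      ≡⟨ *-assoc (suc (2 * u)) 2 (2 ^ v) ⟩
    suc (2 * u) * 2 ^ suc v      ∎)
    where open ≡-Reasoning

¬2^k⇒odd-factor : ∀ m .{{_ : NonZero m}} → ¬ (∃[ k ] m ≡ 2 ^ k) → ∃[ t ] ∃[ d ] m ≡ suc (2 * suc t) * d
¬2^k⇒odd-factor m ¬2^k with 2-adic m
... | v , zero  , m≡2^v = ⊥-elim (¬2^k (v , trans m≡2^v (*-identityˡ (2 ^ v))))
... | v , suc t , m≡    = t , 2 ^ v , m≡

2∤m+1+m : ∀ m → ¬ 2 ∣ m + suc m
2∤m+1+m m (divides q m+1+m≡q*2) = even≢odd q m (begin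
  2 * q          ≡⟨ *-comm 2 q ⟩
  q * 2          ≡⟨ m+1+m≡q*2 ⟨
  m + suc m      ≡⟨ +-suc m m ⟩
  suc (m + m)    ≡⟨ cong (λ k → suc (m + k)) (+-identityʳ m) ⟨
  suc (2 * m)    ∎)
  where open ≡-Reasoning

2∣m+n∧m≤1+n∧n≤1+m⇒m≡n : ∀ {m n} → 2 ∣ m + n → m ≤ suc n → n ≤ suc m → m ≡ n
2∣m+n∧m≤1+n∧n≤1+m⇒m≡n {m} {n} 2∣m+n m≤1+n n≤1+m with <-cmp m n
... | tri≈ _ m≡n _ = m≡n
... | tri< m<n _ _ = ⊥-elim (2∤m+1+m m (subst (λ k → 2 ∣ m + k) (≤-antisym n≤1+m m<n) 2∣m+n))
... | tri> _ _ n<m =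
  ⊥-elim (2∤m+1+m n (subst (2 ∣_) (trans (cong (_+ n) (≤-antisym m≤1+n n<m)) (+-comm (suc n) n)) 2∣m+n))

even? : ℕ → Bool
even? m = does (m % 2 ≟ℕ 0)

even?-suc : ∀ m → even? (suc m) ≡ not (even? m)
even?-suc m = trans (cong (λ r → does (r ≟ℕ 0)) (%-distribˡ-+ 1 m 2)) (flip-bit (m % 2) (m%n<n m 2))
  where
  flip-bit : ∀ r → r < 2 → does (suc r % 2 ≟ℕ 0) ≡ not (does (r ≟ℕ 0))
  flip-bit 0 _ = refl
  flip-bit 1 _ = refl
  flip-bit (suc (suc r)) (s≤s (s≤s ()))

even?-+odd : ∀ m u → even? (m + suc (2 * u)) ≡ not (even? m)
even?-+odd m u = begin
  even? (m + suc (2 * u))    ≡⟨ cong even? (+-suc m (2 * u)) ⟩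
  even? (suc (m + 2 * u))    ≡⟨ even?-suc (m + 2 * u) ⟩
  not (even? (m + 2 * u))    ≡⟨ cong (λ r → not (does (r ≟ℕ 0))) [m+2u]%2≡m%2 ⟩
  not (even? m)              ∎
  where
  open ≡-Reasoning
  [m+2u]%2≡m%2 : (m + 2 * u) % 2 ≡ m % 2
  [m+2u]%2≡m%2 = trans (cong (λ k → (m + k) % 2) (*-comm 2 u)) ([m+kn]%n≡m%n m u 2)

[m%2^k]/2^v%2≡m/2^v%2 : ∀ {k v} .{{_ : NonZero (2 ^ k)}} .{{_ : NonZero (2 ^ v)}} → v < k →
  ∀ m → m % 2 ^ k / 2 ^ v % 2 ≡ m / 2 ^ v % 2
[m%2^k]/2^v%2≡m/2^v%2 {k} {v} v<k m = begin
  m % 2 ^ k / 2 ^ v % 2               ≡⟨ cong (λ r → r / 2 ^ v % 2) (%-congʳ 2^k≡2^K*2^v) ⟩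
  m % (2 ^ K * 2 ^ v) / 2 ^ v % 2     ≡⟨ cong (_% 2) (m%[n*o]/o≡m/o%n m (2 ^ K) (2 ^ v)) ⟩
  m / 2 ^ v % 2 ^ K % 2               ≡⟨ m∣n⇒o%n%m≡o%m 2 (2 ^ K) (m / 2 ^ v) (2∣2^j (m<n⇒0<n∸m v<k)) ⟩
  m / 2 ^ v % 2                       ∎
  where
  open ≡-Reasoning
  K : ℕ
  K = k ∸ v
  instance
    2^K-nonZero : NonZero (2 ^ K)
    2^K-nonZero = m^n≢0 2 K
    2^K*2^v-nonZero : NonZero (2 ^ K * 2 ^ v)
    2^K*2^v-nonZero = m*n≢0 (2 ^ K) (2 ^ v)
  2^k≡2^K*2^v : 2 ^ k ≡ 2 ^ K * 2 ^ v
  2^k≡2^K*2^v = trans (cong (2 ^_) (sym (m∸n+n≡m (<⇒≤ v<k)))) (^-distribˡ-+-* 2 K v)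
  2∣2^j : ∀ {j} → 0 < j → 2 ∣ 2 ^ j
  2∣2^j {suc j} _ = m∣m*n (2 ^ j)

-- Counting elements of subsets of Fin n

χ : Bool → ℕ
χ true  = 1
χ false = 0

χ-not+χ : ∀ b → χ (not b) + χ b ≡ 1
χ-not+χ true  = refl
χ-not+χ false = refl

2*[χp+χq]≤1⇒p≡false : ∀ p q → 2 * (χ p + χ q) ≤ 1 → p ≡ false
2*[χp+χq]≤1⇒p≡false true  true  (s≤s ())
2*[χp+χq]≤1⇒p≡false true  false (s≤s ())
2*[χp+χq]≤1⇒p≡false false q     _ = refl

local-balance⇔ : ∀ p q {i o M N} → M ≡ 1 + (χ p + (χ q + i)) → N ≡ χ (not p) + (χ (not q) + o) →
  o ≤ i ⇔ N + 2 * (χ p + χ q) ≤ suc M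
local-balance⇔ p q {i} {o} refl refl = mk⇔
  (λ o≤i → subst₂ _≤_ (sym N-eq) (sym M-eq) (+-monoʳ-≤ c o≤i))
  (λ le → +-cancelˡ-≤ c o i (subst₂ _≤_ N-eq M-eq le))
  where
  open +-*-Solver
  open ≡-Reasoning
  c : ℕ
  c = 2 + (χ p + χ q)
  N-eq : χ (not p) + (χ (not q) + o) + 2 * (χ p + χ q) ≡ c + o
  N-eq = begin
    χ (not p) + (χ (not q) + o) + 2 * (χ p + χ q)
      ≡⟨ solve 5 (λ p̄ q̄ o p q → p̄ :+ (q̄ :+ o) :+ con 2 :* (p :+ q) := (p̄ :+ p) :+ (q̄ :+ q) :+ (p :+ q) :+ o)
               refl (χ (not p)) (χ (not q)) o (χ p) (χ q) ⟩
    (χ (not p) + χ p) + (χ (not q) + χ q) + (χ p + χ q) + o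
      ≡⟨ cong₂ (λ u v → u + v + (χ p + χ q) + o) (χ-not+χ p) (χ-not+χ q) ⟩
    c + o ∎
  M-eq : suc (1 + (χ p + (χ q + i))) ≡ c + i
  M-eq = cong (λ k → suc (suc k)) (sym (+-assoc (χ p) (χ q) i))

Distinct₃ : ∀ {A : Set} → A → A → A → Set
Distinct₃ i j k = j ≢ i × k ≢ i × k ≢ j

lookup-injective : ∀ {n} {p q : Subset n} → lookup p ≗ lookup q → p ≡ q
lookup-injective {p = p} {q} p≗q = trans (sym (tabulate∘lookup p)) (trans (tabulate-cong p≗q) (tabulate∘lookup q))

∁-involutive : ∀ {n} (p : Subset n) → ∁ (∁ p) ≡ p
∁-involutive p = trans (sym (map-∘ not not p)) (trans (map-cong not-involutive p) (map-id p))

lookup-remove : ∀ {n} (p : Subset n) (x y : Fin n) → lookup (p - x) y ≡ lookup p y ∧ not (does (y ≟ x))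
lookup-remove (s ∷ p) zero    zero    = sym (∧-zeroʳ s)
lookup-remove (s ∷ p) zero    (suc y) = trans (cong (λ q → lookup q y) (p─⊥≡p p)) (sym (∧-identityʳ _))
lookup-remove (s ∷ p) (suc x) zero    = sym (∧-identityʳ s)
lookup-remove (s ∷ p) (suc x) (suc y) = lookup-remove p x y

lookup-remove-≢ : ∀ {n} (p : Subset n) {x y : Fin n} → y ≢ x → lookup (p - x) y ≡ lookup p y
lookup-remove-≢ p {x} {y} y≢x = begin
  lookup (p - x) y                  ≡⟨ lookup-remove p x y ⟩
  lookup p y ∧ not (does (y ≟ x))   ≡⟨ cong (λ b → lookup p y ∧ not b) (dec-false (y ≟ x) y≢x) ⟩
  lookup p y ∧ true                 ≡⟨ ∧-identityʳ _ ⟩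
  lookup p y                        ∎
  where open ≡-Reasoning

lookup-remove-self : ∀ {n} (p : Subset n) (x : Fin n) → lookup (p - x) x ≡ false
lookup-remove-self (s ∷ p) zero    = refl
lookup-remove-self (s ∷ p) (suc x) = lookup-remove-self p x

lookup-remove₃ : ∀ {n} (p : Subset n) (i j k y : Fin n) →
  lookup (p - i - j - k) y ≡ ((lookup p y ∧ not (does (y ≟ i))) ∧ not (does (y ≟ j))) ∧ not (does (y ≟ k))
lookup-remove₃ p i j k y = begin
  lookup (p - i - j - k) y
    ≡⟨ lookup-remove (p - i - j) k y ⟩
  lookup (p - i - j) y ∧ not (does (y ≟ k))
    ≡⟨ cong (_∧ not (does (y ≟ k))) (lookup-remove (p - i) j y) ⟩
  (lookup (p - i) y ∧ not (does (y ≟ j))) ∧ not (does (y ≟ k))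
    ≡⟨ cong (λ b → (b ∧ not (does (y ≟ j))) ∧ not (does (y ≟ k))) (lookup-remove p i y) ⟩
  ((lookup p y ∧ not (does (y ≟ i))) ∧ not (does (y ≟ j))) ∧ not (does (y ≟ k)) ∎
  where open ≡-Reasoning

x∈p-y⇒x∈p : ∀ {n} {p : Subset n} {x y} → x ∈ p - y → x ∈ p
x∈p-y⇒x∈p = p─q⊆p _ _

x∈p-y⇒x≢y : ∀ {n} {p : Subset n} {x y : Fin n} → x ∈ p - y → x ≢ y
x∈p-y⇒x≢y {p = p} {x} x∈p-x refl with trans (sym ([]=⇒lookup x∈p-x)) (lookup-remove-self p x)
... | ()

x∈p-i-j-k⁺ : ∀ {n} {p : Subset n} {x i j k} → x ∈ p → x ≢ i → x ≢ j → x ≢ k → x ∈ p - i - j - k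
x∈p-i-j-k⁺ x∈p x≢i x≢j x≢k = x∈p∧x≢y⇒x∈p-y (x∈p∧x≢y⇒x∈p-y (x∈p∧x≢y⇒x∈p-y x∈p x≢i) x≢j) x≢k

x∈p-i-j-k⁻ : ∀ {n} {p : Subset n} {x i j k} → x ∈ p - i - j - k → x ∈ p × x ≢ i × x ≢ j × x ≢ k
x∈p-i-j-k⁻ x∈ =
  x∈p-y⇒x∈p (x∈p-y⇒x∈p (x∈p-y⇒x∈p x∈)) ,
  x∈p-y⇒x≢y (x∈p-y⇒x∈p (x∈p-y⇒x∈p x∈)) , x∈p-y⇒x≢y (x∈p-y⇒x∈p x∈) , x∈p-y⇒x≢y x∈

∣p∣≡χ+∣p-x∣ : ∀ {n} (p : Subset n) (x : Fin n) → ∣ p ∣ ≡ χ (lookup p x) + ∣ p - x ∣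
∣p∣≡χ+∣p-x∣ (inside  ∷ p) zero    = cong (suc ∘ ∣_∣) (sym (p─⊥≡p p))
∣p∣≡χ+∣p-x∣ (outside ∷ p) zero    = cong ∣_∣ (sym (p─⊥≡p p))
∣p∣≡χ+∣p-x∣ (inside  ∷ p) (suc x) = trans (cong suc (∣p∣≡χ+∣p-x∣ p x)) (sym (+-suc _ _))
∣p∣≡χ+∣p-x∣ (outside ∷ p) (suc x) = ∣p∣≡χ+∣p-x∣ p x

x∈p⇒∣p∣≡1+∣p-x∣ : ∀ {n} {p : Subset n} {x} → x ∈ p → ∣ p ∣ ≡ suc ∣ p - x ∣
x∈p⇒∣p∣≡1+∣p-x∣ {p = p} {x} x∈p = trans (∣p∣≡χ+∣p-x∣ p x) (cong (λ b → χ b + ∣ p - x ∣) ([]=⇒lookup x∈p))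

∣p∣≡χ₃+∣p-i-j-k∣ : ∀ {n} (p : Subset n) {i j k : Fin n} → Distinct₃ i j k →
  ∣ p ∣ ≡ χ (lookup p i) + (χ (lookup p j) + (χ (lookup p k) + ∣ p - i - j - k ∣))
∣p∣≡χ₃+∣p-i-j-k∣ p {i} {j} {k} (j≢i , k≢i , k≢j) = begin
  ∣ p ∣
    ≡⟨ ∣p∣≡χ+∣p-x∣ p i ⟩
  χ (lookup p i) + ∣ p - i ∣
    ≡⟨ cong (χ (lookup p i) +_) (∣p∣≡χ+∣p-x∣ (p - i) j) ⟩
  χ (lookup p i) + (χ (lookup (p - i) j) + ∣ p - i - j ∣)
    ≡⟨ cong (λ m → χ (lookup p i) + (χ (lookup (p - i) j) + m)) (∣p∣≡χ+∣p-x∣ (p - i - j) k) ⟩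
  χ (lookup p i) + (χ (lookup (p - i) j) + (χ (lookup (p - i - j) k) + ∣ p - i - j - k ∣))
    ≡⟨ cong₂ (λ b c → χ (lookup p i) + (χ b + (χ c + ∣ p - i - j - k ∣))) lookup-j lookup-k ⟩
  χ (lookup p i) + (χ (lookup p j) + (χ (lookup p k) + ∣ p - i - j - k ∣)) ∎
  where
  open ≡-Reasoning
  lookup-j : lookup (p - i) j ≡ lookup p j
  lookup-j = lookup-remove-≢ p j≢i
  lookup-k : lookup (p - i - j) k ≡ lookup p k
  lookup-k = trans (lookup-remove-≢ (p - i) k≢j) (lookup-remove-≢ p k≢i)

∣p∣≡3+∣p-i-j-k∣ : ∀ {n} {p : Subset n} {i j k : Fin n} → Distinct₃ i j k → i ∈ p → j ∈ p → k ∈ p →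
  ∣ p ∣ ≡ 3 + ∣ p - i - j - k ∣
∣p∣≡3+∣p-i-j-k∣ {p = p} {i} {j} {k} distinct i∈p j∈p k∈p = trans (∣p∣≡χ₃+∣p-i-j-k∣ p distinct)
  (cong₂ _+_ (χ∈ i∈p) (cong₂ _+_ (χ∈ j∈p) (cong (_+ ∣ p - i - j - k ∣) (χ∈ k∈p))))
  where
  χ∈ : ∀ {x} → x ∈ p → χ (lookup p x) ≡ 1
  χ∈ = cong χ ∘ []=⇒lookup

∣∁p∣≡3⇒p≡⊤-i-j-k : ∀ {n} {p : Subset n} {i j k : Fin n} → Distinct₃ i j k → ∣ ∁ p ∣ ≡ 3 →
  i ∉ p → j ∉ p → k ∉ p → p ≡ ⊤ - i - j - k
∣∁p∣≡3⇒p≡⊤-i-j-k {p = p} {i} {j} {k} distinct ∣∁p∣≡3 i∉p j∉p k∉p = ⊆-antisym p⊆ ⊆p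
  where
  ∣∁p-i-j-k∣≡0 : ∣ ∁ p - i - j - k ∣ ≡ 0
  ∣∁p-i-j-k∣≡0 = +-cancelˡ-≡ 3 _ 0
    (trans (sym (∣p∣≡3+∣p-i-j-k∣ distinct (x∉p⇒x∈∁p i∉p) (x∉p⇒x∈∁p j∉p) (x∉p⇒x∈∁p k∉p))) ∣∁p∣≡3)
  p⊆ : p ⊆ ⊤ - i - j - k
  p⊆ {z} z∈p = x∈p-i-j-k⁺ ∈⊤ (apart i∉p) (apart j∉p) (apart k∉p)
    where
    apart : ∀ {w} → w ∉ p → z ≢ w
    apart w∉p refl = w∉p z∈p
  ⊆p : ⊤ - i - j - k ⊆ p
  ⊆p {z} z∈ with x∈p-i-j-k⁻ z∈
  ... | _ , z≢i , z≢j , z≢k = x∉∁p⇒x∈p λ z∈∁p →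
    n≮0 (subst (∣ ∁ p - i - j - k - z ∣ <_) ∣∁p-i-j-k∣≡0 (x∈p⇒∣p-x∣<∣p∣ (x∈p-i-j-k⁺ z∈∁p z≢i z≢j z≢k)))

∣p∣≡suc⇒Nonempty : ∀ {n m} (p : Subset n) → ∣ p ∣ ≡ suc m → Nonempty p
∣p∣≡suc⇒Nonempty (inside  ∷ p) _ = zero , here
∣p∣≡suc⇒Nonempty (outside ∷ p) ∣p∣≡1+m with ∣p∣≡suc⇒Nonempty p ∣p∣≡1+m
... | x , x∈p = suc x , there x∈p

∣p∣+∣∁p∣≡n : ∀ {n} (p : Subset n) → ∣ p ∣ + ∣ ∁ p ∣ ≡ n
∣p∣+∣∁p∣≡n p = trans (cong (∣ p ∣ +_) (∣∁p∣≡n∸∣p∣ p)) (m+[n∸m]≡n (∣p∣≤n p))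

∣p∣≡∑χ : ∀ {n} (p : Subset n) → ∣ p ∣ ≡ sum (χ ∘ lookup p)
∣p∣≡∑χ []            = refl
∣p∣≡∑χ (inside  ∷ p) = cong suc (∣p∣≡∑χ p)
∣p∣≡∑χ (outside ∷ p) = ∣p∣≡∑χ p

∣p∣-permute : ∀ {n} (p : Subset n) (π : Permutation n n) → ∣ p ∣ ≡ ∣ tabulate (lookup p ∘ (π ⟨$⟩ʳ_)) ∣
∣p∣-permute p π = begin
  ∣ p ∣                                  ≡⟨ ∣p∣≡∑χ p ⟩
  sum (χ ∘ lookup p)                     ≡⟨ sum-permute (χ ∘ lookup p) π ⟩
  sum (χ ∘ lookup p ∘ (π ⟨$⟩ʳ_))         ≡⟨ sum-cong-≗ (cong χ ∘ sym ∘ lookup∘tabulate (lookup p ∘ (π ⟨$⟩ʳ_))) ⟩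
  sum (χ ∘ lookup pπ)                    ≡⟨ ∣p∣≡∑χ pπ ⟨
  ∣ pπ ∣                                 ∎
  where
  open ≡-Reasoning
  pπ : Subset _
  pπ = tabulate (lookup p ∘ (π ⟨$⟩ʳ_))

module ℤ/ (n : ℕ) .{{_ : NonZero n}} where

  infixl 6 _⊕_
  infixl 7 _·_
  infix  8 ⊖_

  _⊕_ : Fin n → Fin n → Fin n
  x ⊕ y = (toℕ x + toℕ y) mod n

  ⊖_ : Fin n → Fin n
  ⊖_ = negℤ n

  0ℤ : Fin n
  0ℤ = zeroℤ n

  _·_ : ℕ → Fin n → Fin n
  j · a = (j * toℕ a) mod n

  toℕ-mod : ∀ m → toℕ (m mod n) ≡ m % n
  toℕ-mod m = toℕ-fromℕ< _

  mod-cong : ∀ {m m′} → m % n ≡ m′ % n → m mod n ≡ m′ mod n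
  mod-cong eq = toℕ-injective (trans (toℕ-mod _) (trans eq (sym (toℕ-mod _))))

  toℕ-mod-id : (x : Fin n) → toℕ x mod n ≡ x
  toℕ-mod-id x = toℕ-injective (trans (toℕ-mod _) (m<n⇒m%n≡m (toℕ<n x)))

  [m+k%n]%n≡[m+k]%n : ∀ m k → (m + k % n) % n ≡ (m + k) % n
  [m+k%n]%n≡[m+k]%n m k = begin
    (m + k % n) % n          ≡⟨ %-distribˡ-+ m (k % n) n ⟩
    (m % n + k % n % n) % n  ≡⟨ cong (λ r → (m % n + r) % n) (m%n%n≡m%n k n) ⟩
    (m % n + k % n) % n      ≡⟨ %-distribˡ-+ m k n ⟨
    (m + k) % n              ∎
    where open ≡-Reasoning

  0%n≡0 : 0 % n ≡ 0
  0%n≡0 = m<n⇒m%n≡m (>-nonZero⁻¹ n)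

  toℕ-0ℤ : toℕ 0ℤ ≡ 0
  toℕ-0ℤ = trans (toℕ-mod 0) 0%n≡0

  n-mod-n : n mod n ≡ 0ℤ
  n-mod-n = mod-cong (trans (n%n≡0 n) (sym 0%n≡0))

  ⊕-modʳ : (x : Fin n) (m : ℕ) → x ⊕ m mod n ≡ (toℕ x + m) mod n
  ⊕-modʳ x m = mod-cong (trans (cong (λ r → (toℕ x + r) % n) (toℕ-mod m)) ([m+k%n]%n≡[m+k]%n (toℕ x) m))

  ⊕-comm : ∀ x y → x ⊕ y ≡ y ⊕ x
  ⊕-comm x y = cong (_mod n) (+-comm (toℕ x) (toℕ y))

  ⊕-modˡ : (m : ℕ) (y : Fin n) → m mod n ⊕ y ≡ (m + toℕ y) mod n
  ⊕-modˡ m y = trans (⊕-comm _ y) (trans (⊕-modʳ y m) (cong (_mod n) (+-comm (toℕ y) m)))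

  ⊕-assoc : ∀ x y z → x ⊕ y ⊕ z ≡ x ⊕ (y ⊕ z)
  ⊕-assoc x y z = begin
    x ⊕ y ⊕ z                         ≡⟨ ⊕-modˡ (toℕ x + toℕ y) z ⟩
    (toℕ x + toℕ y + toℕ z) mod n     ≡⟨ cong (_mod n) (+-assoc (toℕ x) (toℕ y) (toℕ z)) ⟩
    (toℕ x + (toℕ y + toℕ z)) mod n   ≡⟨ ⊕-modʳ x (toℕ y + toℕ z) ⟨
    x ⊕ (y ⊕ z)                       ∎
    where open ≡-Reasoning

  ⊕-identityʳ : ∀ x → x ⊕ 0ℤ ≡ x
  ⊕-identityʳ x = trans (⊕-modʳ x 0) (trans (cong (_mod n) (+-identityʳ (toℕ x))) (toℕ-mod-id x))

  ⊕-inverseʳ : ∀ x → x ⊕ ⊖ x ≡ 0ℤ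
  ⊕-inverseʳ x = begin
    x ⊕ ⊖ x                       ≡⟨ ⊕-modʳ x (n ∸ toℕ x) ⟩
    (toℕ x + (n ∸ toℕ x)) mod n   ≡⟨ cong (_mod n) (m+[n∸m]≡n (<⇒≤ (toℕ<n x))) ⟩
    n mod n                       ≡⟨ n-mod-n ⟩
    0ℤ                            ∎
    where open ≡-Reasoning

  ⊕-isAbelianGroup : IsAbelianGroup _≡_ _⊕_ 0ℤ ⊖_
  ⊕-isAbelianGroup = record
    { isGroup = record
      { isMonoid = record
        { isSemigroup = record
          { isMagma = record { isEquivalence = isEquivalence ; ∙-cong = cong₂ _⊕_ }
          ; assoc = ⊕-assoc
          }
        ; identity = (λ x → trans (⊕-comm 0ℤ x) (⊕-identityʳ x)) , ⊕-identityʳ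
        }
      ; inverse = (λ x → trans (⊕-comm (⊖ x) x) (⊕-inverseʳ x)) , ⊕-inverseʳ
      ; ⁻¹-cong = cong ⊖_
      }
    ; comm = ⊕-comm
    }

  ⊕-abelianGroup : AbelianGroup _ _
  ⊕-abelianGroup = record { isAbelianGroup = ⊕-isAbelianGroup }

  open AbelianGroupProperties ⊕-abelianGroup public
    using (ε⁻¹≈ε; ⁻¹-involutive; ⁻¹-injective; xyx⁻¹≈y; //-rightDividesˡ)

  diffℤ≡⊕⊖ : ∀ x y → diffℤ n x y ≡ y ⊕ ⊖ x
  diffℤ≡⊕⊖ x y = sym (⊕-modʳ y (n ∸ toℕ x))

  diffℤ-⊕ : ∀ x z → diffℤ n x (x ⊕ z) ≡ z
  diffℤ-⊕ x z = trans (diffℤ≡⊕⊖ x (x ⊕ z)) (xyx⁻¹≈y x z)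

  ⊕-diffℤ : ∀ x y → x ⊕ diffℤ n x y ≡ y
  ⊕-diffℤ x y = trans (cong (x ⊕_) (diffℤ≡⊕⊖ x y)) (trans (⊕-comm x _) (//-rightDividesˡ x y))

  diffℤ≡⇔ : ∀ {x y c} → diffℤ n x y ≡ c ⇔ y ≡ x ⊕ c
  diffℤ≡⇔ {x} {y} = mk⇔ (λ { refl → sym (⊕-diffℤ x y) }) (λ { refl → diffℤ-⊕ x _ })

  translation : Fin n → Permutation n n
  translation x = permutation (x ⊕_) (diffℤ n x) (⊕-diffℤ x) (diffℤ-⊕ x)

  ⊕-cancelˡ-≢ : ∀ x {u v} → u ≢ v → x ⊕ u ≢ x ⊕ v
  ⊕-cancelˡ-≢ x {u} {v} u≢v x⊕u≡x⊕v =
    u≢v (trans (sym (diffℤ-⊕ x u)) (trans (cong (diffℤ n x) x⊕u≡x⊕v) (diffℤ-⊕ x v)))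

  Distinct₃-translate : ∀ x {i j k} → Distinct₃ i j k → Distinct₃ (x ⊕ i) (x ⊕ j) (x ⊕ k)
  Distinct₃-translate x (j≢i , k≢i , k≢j) = ⊕-cancelˡ-≢ x j≢i , ⊕-cancelˡ-≢ x k≢i , ⊕-cancelˡ-≢ x k≢j

  ⊖-≢0ℤ : ∀ {a} → a ≢ 0ℤ → ⊖ a ≢ 0ℤ
  ⊖-≢0ℤ a≢0 ⊖a≡0 = a≢0 (trans (sym (⁻¹-involutive _)) (trans (cong ⊖_ ⊖a≡0) ε⁻¹≈ε))

  Distinct₃-± : ∀ {a} → a ≢ 0ℤ → ⊖ a ≢ a → Distinct₃ 0ℤ a (⊖ a)
  Distinct₃-± a≢0 ⊖a≢a = a≢0 , ⊖-≢0ℤ a≢0 , ⊖a≢a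

  toℕ-≢0 : ∀ {a} → a ≢ 0ℤ → toℕ a ≢ 0
  toℕ-≢0 a≢0 a≡0 = a≢0 (toℕ-injective (trans a≡0 (sym toℕ-0ℤ)))

  toℕ-⊖ : ∀ {a} → a ≢ 0ℤ → toℕ (⊖ a) ≡ n ∸ toℕ a
  toℕ-⊖ {a} a≢0 = trans (toℕ-mod _) (m<n⇒m%n≡m (∸-monoʳ-< (n≢0⇒n>0 (toℕ-≢0 a≢0)) (<⇒≤ (toℕ<n a))))

  ⊖a≡a⇒2a≡n : ∀ {a} → a ≢ 0ℤ → ⊖ a ≡ a → 2 * toℕ a ≡ n
  ⊖a≡a⇒2a≡n {a} a≢0 ⊖a≡a = begin
    2 * toℕ a            ≡⟨ cong (toℕ a +_) (+-identityʳ (toℕ a)) ⟩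
    toℕ a + toℕ a        ≡⟨ cong (_+ toℕ a) (trans (cong toℕ (sym ⊖a≡a)) (toℕ-⊖ a≢0)) ⟩
    n ∸ toℕ a + toℕ a    ≡⟨ m∸n+n≡m (<⇒≤ (toℕ<n a)) ⟩
    n                    ∎
    where open ≡-Reasoning

  ·-suc : ∀ j a → suc j · a ≡ j · a ⊕ a
  ·-suc j a = sym (trans (⊕-modˡ (j * toℕ a) a) (cong (_mod n) (+-comm (j * toℕ a) (toℕ a))))

  element-of-odd-order : ∀ t {d} → n ≡ suc (2 * suc t) * d →
    ∃[ a ] n ≡ suc (2 * suc t) * toℕ a × Distinct₃ 0ℤ a (⊖ a)
  element-of-odd-order t {d} n≡m*d = a , subst (λ e → n ≡ m * e) (sym toℕa≡d) n≡m*d , Distinct₃-± a≢0 ⊖a≢a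
    where
    m : ℕ
    m = suc (2 * suc t)
    d≢0 : d ≢ 0
    d≢0 d≡0 = ≢-nonZero⁻¹ n (trans n≡m*d (trans (cong (m *_) d≡0) (*-zeroʳ m)))
    instance
      d-nonZero : NonZero d
      d-nonZero = ≢-nonZero d≢0
    d<n : d < n
    d<n = subst (d <_) (trans (*-comm d m) (sym n≡m*d)) (m<m*n d m (s≤s (s≤s z≤n)))
    a : Fin n
    a = fromℕ< d<n
    toℕa≡d : toℕ a ≡ d
    toℕa≡d = toℕ-fromℕ< d<n
    a≢0 : a ≢ 0ℤ
    a≢0 a≡0 = d≢0 (trans (sym toℕa≡d) (trans (cong toℕ a≡0) toℕ-0ℤ))
    ⊖a≢a : ⊖ a ≢ a
    ⊖a≢a ⊖a≡a = even≢odd 1 (suc t) (*-cancelʳ-≡ 2 m d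
      (trans (subst (λ e → 2 * e ≡ n) toℕa≡d (⊖a≡a⇒2a≡n a≢0 ⊖a≡a)) n≡m*d))

-- Cay(ℤ/n; ℤ/n ∖ {0, ±a}) and its internal partitions

module Cayley (n : ℕ) .{{_ : NonZero n}} where

  open ℤ/ n

  punctured : Fin n → Subset n
  punctured a = ⊤ - 0ℤ - a - ⊖ a

  punctured-isConnectionSet : ∀ a → IsConnectionSet n (punctured a)
  punctured-isConnectionSet a = (λ 0∈ → proj₁ (proj₂ (x∈p-i-j-k⁻ 0∈)) refl) , ⊖-closed
    where
    ⊖-closed : ∀ s → s ∈ punctured a → ⊖ s ∈ punctured a
    ⊖-closed s s∈ with x∈p-i-j-k⁻ s∈
    ... | _ , s≢0 , s≢a , s≢⊖a = x∈p-i-j-k⁺ ∈⊤ (⊖-≢0ℤ s≢0)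
      (λ ⊖s≡a → s≢⊖a (trans (sym (⁻¹-involutive s)) (cong ⊖_ ⊖s≡a)))
      (λ ⊖s≡⊖a → s≢a (⁻¹-injective ⊖s≡⊖a))

  ∣punctured∣ : ∀ {a} → Distinct₃ 0ℤ a (⊖ a) → ∣ punctured a ∣ ≡ n ∸ 3
  ∣punctured∣ {a} distinct = sym (begin
    n ∸ 3                        ≡⟨ cong (_∸ 3) (∣⊤∣≡n n) ⟨
    ∣ ⊤ {n} ∣ ∸ 3                ≡⟨ cong (_∸ 3) (∣p∣≡3+∣p-i-j-k∣ distinct ∈⊤ ∈⊤ ∈⊤) ⟩
    3 + ∣ punctured a ∣ ∸ 3      ≡⟨ m+n∸m≡n 3 ∣ punctured a ∣ ⟩
    ∣ punctured a ∣              ∎)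
    where open ≡-Reasoning

  ∣S∣≡n∸3⇒punctured : ∀ {S} → 2 < n → IsConnectionSet n S → ∣ S ∣ ≡ n ∸ 3 →
    ∃[ a ] Distinct₃ 0ℤ a (⊖ a) × S ≡ punctured a
  ∣S∣≡n∸3⇒punctured {S} 2<n (0∉S , S-closed) ∣S∣≡n∸3 = choose
    where
    ∣∁S∣≡3 : ∣ ∁ S ∣ ≡ 3
    ∣∁S∣≡3 = trans (∣∁p∣≡n∸∣p∣ S) (trans (cong (n ∸_) ∣S∣≡n∸3) (m∸[m∸n]≡n 2<n))
    ∁S-closed : ∀ {z} → z ∈ ∁ S → ⊖ z ∈ ∁ S
    ∁S-closed {z} z∈∁S = x∉p⇒x∈∁p λ ⊖z∈S → x∈∁p⇒x∉p z∈∁S (subst (_∈ S) (⁻¹-involutive z) (S-closed (⊖ z) ⊖z∈S))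
    found : ∀ {c} → c ∈ ∁ S → c ≢ 0ℤ → ⊖ c ≢ c → ∃[ a ] Distinct₃ 0ℤ a (⊖ a) × S ≡ punctured a
    found {c} c∈∁S c≢0 ⊖c≢c = c , distinct ,
      ∣∁p∣≡3⇒p≡⊤-i-j-k distinct ∣∁S∣≡3 0∉S (x∈∁p⇒x∉p c∈∁S) (x∈∁p⇒x∉p (∁S-closed c∈∁S))
      where
      distinct : Distinct₃ 0ℤ c (⊖ c)
      distinct = Distinct₃-± c≢0 ⊖c≢c
    ∣∁S-0∣≡2 : ∣ ∁ S - 0ℤ ∣ ≡ 2
    ∣∁S-0∣≡2 = suc-injective (trans (sym (x∈p⇒∣p∣≡1+∣p-x∣ (x∉p⇒x∈∁p 0∉S))) ∣∁S∣≡3)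
    choose : ∃[ a ] Distinct₃ 0ℤ a (⊖ a) × S ≡ punctured a
    choose with ∣p∣≡suc⇒Nonempty (∁ S - 0ℤ) ∣∁S-0∣≡2
    ... | a , a∈∁S-0 with ⊖ a ≟ a
    ...   | no ⊖a≢a = found (x∈p-y⇒x∈p a∈∁S-0) (x∈p-y⇒x≢y a∈∁S-0) ⊖a≢a
    ...   | yes ⊖a≡a
      with ∣p∣≡suc⇒Nonempty (∁ S - 0ℤ - a) (suc-injective (trans (sym (x∈p⇒∣p∣≡1+∣p-x∣ a∈∁S-0)) ∣∁S-0∣≡2))
    ...     | b , b∈∁S-0-a with ⊖ b ≟ b | x∈p-y⇒x≢y (x∈p-y⇒x∈p b∈∁S-0-a)
    ...       | no ⊖b≢b  | b≢0 = found (x∈p-y⇒x∈p (x∈p-y⇒x∈p b∈∁S-0-a)) b≢0 ⊖b≢b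
    -- a and b would both be n / 2
    ...       | yes ⊖b≡b | b≢0 = ⊥-elim (x∈p-y⇒x≢y b∈∁S-0-a (toℕ-injective (*-cancelˡ-≡ _ _ 2
                  (trans (⊖a≡a⇒2a≡n b≢0 ⊖b≡b) (sym (⊖a≡a⇒2a≡n (x∈p-y⇒x≢y a∈∁S-0) ⊖a≡a))))))

  nbhd-punctured : ∀ a x (A : Subset n) → nbhd n (punctured a) x ∩ A ≡ A - (x ⊕ 0ℤ) - (x ⊕ a) - (x ⊕ ⊖ a)
  nbhd-punctured a x A = lookup-injective λ y → begin
    lookup (nbhd n (punctured a) x ∩ A) y
      ≡⟨ lookup-zipWith _∧_ y (nbhd n (punctured a) x) A ⟩
    lookup (nbhd n (punctured a) x) y ∧ lookup A y
      ≡⟨ cong (_∧ lookup A y) (lookup∘tabulate (lookup (punctured a) ∘ diffℤ n x) y) ⟩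
    lookup (punctured a) (diffℤ n x y) ∧ lookup A y
      ≡⟨ cong (_∧ lookup A y) (lookup-punctured y) ⟩
    ((off y 0ℤ ∧ off y a) ∧ off y (⊖ a)) ∧ lookup A y
      ≡⟨ ∧-comm _ (lookup A y) ⟩
    lookup A y ∧ ((off y 0ℤ ∧ off y a) ∧ off y (⊖ a))
      ≡⟨ ∧-assoc (lookup A y) _ (off y (⊖ a)) ⟨
    (lookup A y ∧ (off y 0ℤ ∧ off y a)) ∧ off y (⊖ a)
      ≡⟨ cong (_∧ off y (⊖ a)) (∧-assoc (lookup A y) (off y 0ℤ) (off y a)) ⟨
    ((lookup A y ∧ off y 0ℤ) ∧ off y a) ∧ off y (⊖ a)
      ≡⟨ lookup-remove₃ A (x ⊕ 0ℤ) (x ⊕ a) (x ⊕ ⊖ a) y ⟨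
    lookup (A - (x ⊕ 0ℤ) - (x ⊕ a) - (x ⊕ ⊖ a)) y ∎
    where
    open ≡-Reasoning
    off : Fin n → Fin n → Bool
    off y c = not (does (y ≟ x ⊕ c))
    shift : ∀ y c → does (diffℤ n x y ≟ c) ≡ does (y ≟ x ⊕ c)
    shift y c = does-⇔ diffℤ≡⇔ (diffℤ n x y ≟ c) (y ≟ x ⊕ c)
    lookup-punctured : ∀ y → lookup (punctured a) (diffℤ n x y) ≡ (off y 0ℤ ∧ off y a) ∧ off y (⊖ a)
    lookup-punctured y
      rewrite lookup-remove₃ ⊤ 0ℤ a (⊖ a) (diffℤ n x y) | lookup-replicate (diffℤ n x y) true
            | shift y 0ℤ | shift y a | shift y (⊖ a) = refl

  ∣A∣≡χ₃+∣nbhd∩A∣ : ∀ {a} → Distinct₃ 0ℤ a (⊖ a) → ∀ x (A : Subset n) →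
    ∣ A ∣ ≡ χ (lookup A x) + (χ (lookup A (x ⊕ a)) + (χ (lookup A (x ⊕ ⊖ a)) + ∣ nbhd n (punctured a) x ∩ A ∣))
  ∣A∣≡χ₃+∣nbhd∩A∣ {a} distinct x A = begin
    ∣ A ∣
      ≡⟨ ∣p∣≡χ₃+∣p-i-j-k∣ A (Distinct₃-translate x distinct) ⟩
    χ (lookup A (x ⊕ 0ℤ)) + (χ (lookup A (x ⊕ a)) + (χ (lookup A (x ⊕ ⊖ a)) + ∣ A - (x ⊕ 0ℤ) - (x ⊕ a) - (x ⊕ ⊖ a) ∣))
      ≡⟨ cong₂ (λ z B → χ (lookup A z) + (χ (lookup A (x ⊕ a)) + (χ (lookup A (x ⊕ ⊖ a)) + ∣ B ∣)))
               (⊕-identityʳ x) (sym (nbhd-punctured a x A)) ⟩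
    χ (lookup A x) + (χ (lookup A (x ⊕ a)) + (χ (lookup A (x ⊕ ⊖ a)) + ∣ nbhd n (punctured a) x ∩ A ∣)) ∎
    where open ≡-Reasoning

  Cohesive : Subset n → Subset n → Set
  Cohesive S A = ∀ x → x ∈ A → ∣ nbhd n S x ∩ ∁ A ∣ ≤ ∣ nbhd n S x ∩ A ∣

  internalPartition⇔ : ∀ {S A} →
    IsInternalPartition n S A ⇔ (Nonempty A × Nonempty (∁ A) × Cohesive S A × Cohesive S (∁ A))
  internalPartition⇔ {S} {A} = mk⇔
    (λ (neA , ne∁A , cond) → neA , ne∁A , (λ x → proj₁ (cond x)) ,
      λ x x∈∁A → subst (_≤ N∩ x (∁ A)) (N∩∁∁ x) (proj₂ (cond x) (x∈∁p⇒x∉p x∈∁A)))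
    (λ (neA , ne∁A , cohA , coh∁A) → neA , ne∁A ,
      λ x → cohA x , λ x∉A → subst (_≤ N∩ x (∁ A)) (sym (N∩∁∁ x)) (coh∁A x (x∉p⇒x∈∁p x∉A)))
    where
    N∩ : Fin n → Subset n → ℕ
    N∩ x B = ∣ nbhd n S x ∩ B ∣
    N∩∁∁ : ∀ x → N∩ x A ≡ N∩ x (∁ (∁ A))
    N∩∁∁ x = cong (N∩ x) (sym (∁-involutive A))

  cohesive-at⇔ : ∀ {a} → Distinct₃ 0ℤ a (⊖ a) → ∀ (A : Subset n) {x} → x ∈ A →
    (∣ nbhd n (punctured a) x ∩ ∁ A ∣ ≤ ∣ nbhd n (punctured a) x ∩ A ∣)
      ⇔ ∣ ∁ A ∣ + 2 * (χ (lookup A (x ⊕ a)) + χ (lookup A (x ⊕ ⊖ a))) ≤ suc ∣ A ∣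
  cohesive-at⇔ {a} distinct A {x} x∈A = local-balance⇔ (lookup A (x ⊕ a)) (lookup A (x ⊕ ⊖ a)) ∣A∣≡ ∣∁A∣≡
    where
    N∩ : Subset n → ℕ
    N∩ B = ∣ nbhd n (punctured a) x ∩ B ∣
    ∣A∣≡ : ∣ A ∣ ≡ 1 + (χ (lookup A (x ⊕ a)) + (χ (lookup A (x ⊕ ⊖ a)) + N∩ A))
    ∣A∣≡ = trans (∣A∣≡χ₃+∣nbhd∩A∣ distinct x A)
                 (cong (λ b → χ b + (χ (lookup A (x ⊕ a)) + (χ (lookup A (x ⊕ ⊖ a)) + N∩ A))) ([]=⇒lookup x∈A))
    χ∁ : ∀ z → χ (lookup (∁ A) z) ≡ χ (not (lookup A z))
    χ∁ z = cong χ (lookup-map z not A)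
    ∣∁A∣≡ : ∣ ∁ A ∣ ≡ χ (not (lookup A (x ⊕ a))) + (χ (not (lookup A (x ⊕ ⊖ a))) + N∩ (∁ A))
    ∣∁A∣≡ = trans (∣A∣≡χ₃+∣nbhd∩A∣ distinct x (∁ A))
      (cong₂ _+_ (trans (χ∁ x) (cong (χ ∘ not) ([]=⇒lookup x∈A)))
                 (cong₂ _+_ (χ∁ (x ⊕ a)) (cong (_+ N∩ (∁ A)) (χ∁ (x ⊕ ⊖ a)))))

  cohesive⇒∣∁A∣≤1+∣A∣ : ∀ {a A x} → Distinct₃ 0ℤ a (⊖ a) → Cohesive (punctured a) A → x ∈ A → ∣ ∁ A ∣ ≤ suc ∣ A ∣
  cohesive⇒∣∁A∣≤1+∣A∣ {a} {A} {x} distinct coh x∈A =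
    m+n≤o⇒m≤o ∣ ∁ A ∣ (Equivalence.to (cohesive-at⇔ distinct A x∈A) (coh x x∈A))

  cohesive∧balanced⇒x⊕a∉A : ∀ {a A x} → Distinct₃ 0ℤ a (⊖ a) → Cohesive (punctured a) A → ∣ A ∣ ≡ ∣ ∁ A ∣ →
    x ∈ A → lookup A (x ⊕ a) ≡ false
  cohesive∧balanced⇒x⊕a∉A {a} {A} {x} distinct coh ∣A∣≡∣∁A∣ x∈A =
    2*[χp+χq]≤1⇒p≡false (lookup A (x ⊕ a)) (lookup A (x ⊕ ⊖ a)) (+-cancelˡ-≤ ∣ ∁ A ∣ (2 * k) 1
      (subst (∣ ∁ A ∣ + 2 * k ≤_) (trans (cong suc ∣A∣≡∣∁A∣) (+-comm 1 ∣ ∁ A ∣))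
        (Equivalence.to (cohesive-at⇔ distinct A x∈A) (coh x x∈A))))
    where
    k : ℕ
    k = χ (lookup A (x ⊕ a)) + χ (lookup A (x ⊕ ⊖ a))

  Flips : Fin n → Subset n → Set
  Flips a A = ∀ x → lookup A (x ⊕ a) ≡ not (lookup A x)

  internalPartition⇒flips : ∀ {a A} → 2 ∣ n → Distinct₃ 0ℤ a (⊖ a) →
    IsInternalPartition n (punctured a) A → Flips a A
  internalPartition⇒flips {a} {A} 2∣n distinct partition x
    with Equivalence.to (internalPartition⇔ {punctured a} {A}) partition
  ... | (x₀ , x₀∈A) , (y₀ , y₀∈∁A) , cohA , coh∁A = flip-at (lookup A x) refl
    where
    ∣∁∁A∣≡∣A∣ : ∣ ∁ (∁ A) ∣ ≡ ∣ A ∣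
    ∣∁∁A∣≡∣A∣ = cong ∣_∣ (∁-involutive A)
    balanced : ∣ A ∣ ≡ ∣ ∁ A ∣
    balanced = 2∣m+n∧m≤1+n∧n≤1+m⇒m≡n (subst (2 ∣_) (sym (∣p∣+∣∁p∣≡n A)) 2∣n)
      (subst (_≤ suc ∣ ∁ A ∣) ∣∁∁A∣≡∣A∣ (cohesive⇒∣∁A∣≤1+∣A∣ distinct coh∁A y₀∈∁A))
      (cohesive⇒∣∁A∣≤1+∣A∣ distinct cohA x₀∈A)
    flip-at : ∀ b → lookup A x ≡ b → lookup A (x ⊕ a) ≡ not b
    flip-at true  A[x]≡true  = cohesive∧balanced⇒x⊕a∉A distinct cohA balanced (lookup⇒[]= x A A[x]≡true)
    flip-at false A[x]≡false = begin
      lookup A (x ⊕ a)              ≡⟨ not-involutive _ ⟨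
      not (not (lookup A (x ⊕ a)))  ≡⟨ cong not (lookup-map (x ⊕ a) not A) ⟨
      not (lookup (∁ A) (x ⊕ a))    ≡⟨ cong not (cohesive∧balanced⇒x⊕a∉A distinct coh∁A
                                          (trans (sym balanced) (sym ∣∁∁A∣≡∣A∣)) x∈∁A) ⟩
      true                          ∎
      where
      open ≡-Reasoning
      x∈∁A : x ∈ ∁ A
      x∈∁A = lookup⇒[]= x (∁ A) (trans (lookup-map x not A) (cong not A[x]≡false))

  Flips-∁ : ∀ {a A} → Flips a A → Flips a (∁ A)
  Flips-∁ {a} {A} flips x = begin
    lookup (∁ A) (x ⊕ a)        ≡⟨ lookup-map (x ⊕ a) not A ⟩
    not (lookup A (x ⊕ a))      ≡⟨ cong not (flips x) ⟩
    not (not (lookup A x))      ≡⟨ cong not (lookup-map x not A) ⟨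
    not (lookup (∁ A) x)        ∎
    where open ≡-Reasoning

  Flips-⊖ : ∀ {a A} → Flips a A → ∀ x → lookup A (x ⊕ ⊖ a) ≡ not (lookup A x)
  Flips-⊖ {a} {A} flips x = begin
    lookup A (x ⊕ ⊖ a)                  ≡⟨ not-involutive _ ⟨
    not (not (lookup A (x ⊕ ⊖ a)))      ≡⟨ cong not (flips (x ⊕ ⊖ a)) ⟨
    not (lookup A (x ⊕ ⊖ a ⊕ a))        ≡⟨ cong (not ∘ lookup A) (//-rightDividesˡ a x) ⟩
    not (lookup A x)                    ∎
    where open ≡-Reasoning

  Flips⇒∣A∣≡∣∁A∣ : ∀ {a A} → Flips a A → ∣ A ∣ ≡ ∣ ∁ A ∣
  Flips⇒∣A∣≡∣∁A∣ {a} {A} flips =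
    trans (∣p∣-permute A (translation a)) (cong ∣_∣ (lookup-injective {p = A-a} {∁ A} A-a≗∁A))
    where
    open ≡-Reasoning
    A-a : Subset n
    A-a = tabulate (lookup A ∘ (a ⊕_))
    A-a≗∁A : lookup A-a ≗ lookup (∁ A)
    A-a≗∁A y = begin
      lookup A-a y                             ≡⟨ lookup∘tabulate (lookup A ∘ (a ⊕_)) y ⟩
      lookup A (a ⊕ y)                         ≡⟨ cong (lookup A) (⊕-comm a y) ⟩
      lookup A (y ⊕ a)                         ≡⟨ flips y ⟩
      not (lookup A y)                         ≡⟨ lookup-map y not A ⟨
      lookup (∁ A) y                           ∎

  Flips⇒Nonempty : ∀ {a A} → Flips a A → Nonempty A
  Flips⇒Nonempty {a} {A} flips with lookup A 0ℤ in A[0]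
  ... | true  = 0ℤ , lookup⇒[]= 0ℤ A A[0]
  ... | false = 0ℤ ⊕ a , lookup⇒[]= (0ℤ ⊕ a) A (trans (flips 0ℤ) (cong not A[0]))

  Flips⇒Cohesive : ∀ {a A} → Distinct₃ 0ℤ a (⊖ a) → Flips a A → Cohesive (punctured a) A
  Flips⇒Cohesive {a} {A} distinct flips x x∈A = Equivalence.from (cohesive-at⇔ distinct A x∈A)
    (subst₂ (λ p q → ∣ ∁ A ∣ + 2 * (χ p + χ q) ≤ suc ∣ A ∣)
      (sym (≡¬A[x]⇒≡false (flips x))) (sym (≡¬A[x]⇒≡false (Flips-⊖ {a} {A} flips x)))
      (≤-trans (≤-reflexive (trans (+-identityʳ ∣ ∁ A ∣) (sym (Flips⇒∣A∣≡∣∁A∣ {a} {A} flips)))) (n≤1+n ∣ A ∣)))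
    where
    ≡¬A[x]⇒≡false : ∀ {b} → b ≡ not (lookup A x) → b ≡ false
    ≡¬A[x]⇒≡false b≡¬A[x] = trans b≡¬A[x] (cong not ([]=⇒lookup x∈A))

  flips⇒internalPartition : ∀ {a A} → Distinct₃ 0ℤ a (⊖ a) → Flips a A → IsInternalPartition n (punctured a) A
  flips⇒internalPartition {a} {A} distinct flips = Equivalence.from (internalPartition⇔ {punctured a} {A})
    ( Flips⇒Nonempty {a} {A} flips , Flips⇒Nonempty {a} {∁ A} flips∁
    , Flips⇒Cohesive {a} {A} distinct flips , Flips⇒Cohesive {a} {∁ A} distinct flips∁ )
    where
    flips∁ : Flips a (∁ A)
    flips∁ = Flips-∁ {a} {A} flips

  2^k⇒Flips : ∀ {k a} → n ≡ 2 ^ k → a ≢ 0ℤ → ∃ (Flips a)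
  2^k⇒Flips {k} {a} n≡2^k a≢0 with 2-adic (toℕ a) {{≢-nonZero (toℕ-≢0 a≢0)}}
  ... | v , u , a≡o*2^v = A , flips
    where
    open ≡-Reasoning
    instance
      2^k-nonZero : NonZero (2 ^ k)
      2^k-nonZero = m^n≢0 2 k
      2^v-nonZero : NonZero (2 ^ v)
      2^v-nonZero = m^n≢0 2 v
    A : Subset n
    A = tabulate (λ y → even? (toℕ y / 2 ^ v))
    v<k : v < k
    v<k = ≰⇒> λ k≤v → <⇒≱ 2^v<2^k (^-monoʳ-≤ 2 k≤v)
      where
      2^v<2^k : 2 ^ v < 2 ^ k
      2^v<2^k = ≤-<-trans (subst (2 ^ v ≤_) (sym a≡o*2^v) (m≤n*m (2 ^ v) (suc (2 * u))))
                          (subst (toℕ a <_) n≡2^k (toℕ<n a))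
    [y+a]/2^v≡y/2^v+o : ∀ y → (toℕ y + toℕ a) / 2 ^ v ≡ toℕ y / 2 ^ v + suc (2 * u)
    [y+a]/2^v≡y/2^v+o y = begin
      (toℕ y + toℕ a) / 2 ^ v                          ≡⟨ cong (λ t → (toℕ y + t) / 2 ^ v) a≡o*2^v ⟩
      (toℕ y + suc (2 * u) * 2 ^ v) / 2 ^ v
        ≡⟨ +-distrib-/-∣ʳ (toℕ y) {d = 2 ^ v} (divides (suc (2 * u)) refl) ⟩
      toℕ y / 2 ^ v + suc (2 * u) * 2 ^ v / 2 ^ v      ≡⟨ cong (toℕ y / 2 ^ v +_) (m*n/n≡m (suc (2 * u)) (2 ^ v)) ⟩
      toℕ y / 2 ^ v + suc (2 * u)                      ∎
    bit-v-flips : ∀ y → toℕ (y ⊕ a) / 2 ^ v % 2 ≡ (toℕ y / 2 ^ v + suc (2 * u)) % 2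
    bit-v-flips y = begin
      toℕ (y ⊕ a) / 2 ^ v % 2
        ≡⟨ cong (λ r → r / 2 ^ v % 2) (trans (toℕ-mod _) (%-congʳ n≡2^k)) ⟩
      (toℕ y + toℕ a) % 2 ^ k / 2 ^ v % 2           ≡⟨ [m%2^k]/2^v%2≡m/2^v%2 v<k (toℕ y + toℕ a) ⟩
      (toℕ y + toℕ a) / 2 ^ v % 2                   ≡⟨ cong (_% 2) ([y+a]/2^v≡y/2^v+o y) ⟩
      (toℕ y / 2 ^ v + suc (2 * u)) % 2             ∎
    flips : Flips a A
    flips y = begin
      lookup A (y ⊕ a)                          ≡⟨ lookup∘tabulate _ (y ⊕ a) ⟩
      even? (toℕ (y ⊕ a) / 2 ^ v)               ≡⟨ cong (λ r → does (r ≟ℕ 0)) (bit-v-flips y) ⟩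
      even? (toℕ y / 2 ^ v + suc (2 * u))       ≡⟨ even?-+odd (toℕ y / 2 ^ v) u ⟩
      not (even? (toℕ y / 2 ^ v))               ≡⟨ cong not (lookup∘tabulate _ y) ⟨
      not (lookup A y)                          ∎

  odd-order⇒¬Flips : ∀ {a A} t → n ≡ suc (2 * t) * toℕ a → ¬ Flips a A
  odd-order⇒¬Flips {a} {A} t n≡[1+2t]*a flips = not-¬ refl (begin
    lookup A 0ℤ                      ≡⟨ cong (lookup A) [1+2t]·a≡0 ⟨
    lookup A (suc (2 * t) · a)       ≡⟨ step (2 * t) ⟩
    not (lookup A ((2 * t) · a))     ≡⟨ cong not (even-multiple t) ⟩
    not (lookup A 0ℤ)                ∎)
    where
    open ≡-Reasoning
    [1+2t]·a≡0 : suc (2 * t) · a ≡ 0ℤ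
    [1+2t]·a≡0 = trans (cong (_mod n) (sym n≡[1+2t]*a)) n-mod-n
    step : ∀ j → lookup A (suc j · a) ≡ not (lookup A (j · a))
    step j = trans (cong (lookup A) (·-suc j a)) (flips (j · a))
    even-multiple : ∀ j → lookup A ((2 * j) · a) ≡ lookup A 0ℤ
    even-multiple zero    = refl
    even-multiple (suc j) = begin
      lookup A ((2 * suc j) · a)            ≡⟨ cong (λ m → lookup A (m · a)) (*-suc 2 j) ⟩
      lookup A (suc (suc (2 * j)) · a)      ≡⟨ step (suc (2 * j)) ⟩
      not (lookup A (suc (2 * j) · a))      ≡⟨ cong not (step (2 * j)) ⟩
      not (not (lookup A ((2 * j) · a)))    ≡⟨ not-involutive _ ⟩
      lookup A ((2 * j) · a)                ≡⟨ even-multiple j ⟩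
      lookup A 0ℤ                           ∎

mainTheorem12 : (n : ℕ) .{{_ : NonZero n}} → 2 < n → 2 ∣ n →
    (∃[ S ] (IsConnectionSet n S × ∣ S ∣ ≡ n ∸ 3 × ¬ HasInternalPartition n S))
      ⇔ (¬ (∃[ k ] n ≡ 2 ^ k))
mainTheorem12 n 2<n 2∣n = mk⇔ no-partition⇒¬2^k ¬2^k⇒no-partition
  where
  open ℤ/ n
  open Cayley n

  no-partition⇒¬2^k : (∃[ S ] (IsConnectionSet n S × ∣ S ∣ ≡ n ∸ 3 × ¬ HasInternalPartition n S)) →
    ¬ (∃[ k ] n ≡ 2 ^ k)
  no-partition⇒¬2^k (S , isConnectionSet , ∣S∣≡n∸3 , ¬partition) (k , n≡2^k)
    with ∣S∣≡n∸3⇒punctured 2<n isConnectionSet ∣S∣≡n∸3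
  ... | a , distinct@(a≢0 , _) , refl with 2^k⇒Flips {k} {a} n≡2^k a≢0
  ...   | A , flips = ¬partition (A , flips⇒internalPartition {a} {A} distinct flips)

  ¬2^k⇒no-partition : ¬ (∃[ k ] n ≡ 2 ^ k) →
    ∃[ S ] (IsConnectionSet n S × ∣ S ∣ ≡ n ∸ 3 × ¬ HasInternalPartition n S)
  ¬2^k⇒no-partition ¬2^k with ¬2^k⇒odd-factor n ¬2^k
  ... | t , d , n≡[3+2t]*d with element-of-odd-order t {d} n≡[3+2t]*d
  ...   | a , n≡[3+2t]*a , distinct =
    punctured a , punctured-isConnectionSet a , ∣punctured∣ distinct ,
    λ (A , partition) →
      odd-order⇒¬Flips {a} {A} (suc t) n≡[3+2t]*a (internalPartition⇒flips {a} {A} 2∣n distinct partition)
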